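{- Let $(G,T)$ be a graft, let $F$ be a minimum join of $(G,T)$, and let $X\subseteq V(G)$ be an extreme set. Let $Y,Z\subseteq V(G)$ be disjoint sets with $Y\cup Z=V(G)\setminus X$, $E_G[Y,Z]=\emptyset$ and $(E_G[Z]\cup\delta_G(Z))\cap F=\emptyset$. Let $(\hat G,\hat T)$ be a graft with $V(\hat G)\supseteq V(G)$, $E(\hat G)\supseteq E(G)$, every edge of $E(\hat G)\setminus E(G)$ joining a vertex of $X$ to a vertex of $V(\hat G)\setminus V(G)$, and $\hat T=T$. Let $\hat Z:=Z\cup(V(\hat G)\setminus V(G))$. Let $Q$ be a subgraph of $\hat G$ with $V(Q)\cap\hat Z\neq\emptyset$. (i) If $Q$ is a circuit, or a path between a vertex in $X$ and a vertex in $X\cup Z$, then $w_F(Q)>0$. (ii) If $Q$ is a path between a vertex $y\in Y$ and a vertex in $X$, then $w_F(Q)>\min_{x\in X}\lambda_{(G,T),F}(x,y)$.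
   Context: All graphs are finite (parallel edges allowed). A graft is a pair $(G,T)$ with $T\subseteq V(G)$; a join is $F\subseteq E(G)$ such that each vertex is incident to an odd number of edges of $F$ iff it lies in $T$; a minimum join is one of minimum size. For $F\subseteq E$ and a subgraph $Q$, $w_F(Q)=|E(Q)\setminus F|-|E(Q)\cap F|$; $\lambda_{(G,T),F}(x,y)$ is the minimum of $w_F(P)$ over paths $P$ of $G$ between $x$ and $y$ ($0$ if $x=y$). A circuit is a cycle. $\delta_G(Z)$ is the set of edges with exactly one end in $Z$, $E_G[Z]$ the edges with both ends in $Z$, $E_G[Y,Z]$ the edges joining $Y$ and $Z$. A set $X\subseteq V(G)$ is extreme if $\lambda_{(G,T),F}(x,y)\ge 0$ for all $x,y\in X$ ($F$ a minimum join; the value does not depend on the choice of $F$). -}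

module Defs where

open import Data.Nat as ℕ using (ℕ; zero; suc; _+_; _%_)
open import Data.Integer as ℤ using (ℤ; +_; -[1+_])
open import Data.Fin using (Fin; _↑ˡ_; _↑ʳ_; _≟_; splitAt)
open import Data.Fin.Subset using (Subset; _∈_; _∉_; ∣_∣; outside)
open import Data.Vec using (Vec; lookup; _++_; replicate)
open import Data.Nat.ListAction using (sum)
open import Data.List using (List; []; _∷_; map; allFin; length)
open import Data.List.Relation.Unary.Unique.Propositional using (Unique)
open import Data.List.Membership.Propositional renaming (_∈_ to _∈ₗ_)
open import Data.Product using (_×_; _,_; proj₁; proj₂; ∃; ∃-syntax; Σ-syntax)
open import Data.Sum using (_⊎_; inj₁; inj₂)
open import Data.Bool using (Bool; true; false; if_then_else_)
open import Relation.Binary.PropositionalEquality using (_≡_)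
open import Relation.Nullary using (¬_; does)

-- A (multi)graph with vertex set Fin n and edge set Fin m:
-- each edge is given by its pair of ends (parallel edges allowed,
-- loops are not excluded; a loop counts twice in a degree).

Graph : ℕ → ℕ → Set
Graph n m = Fin m → Fin n × Fin n

module _ {n m : ℕ} (G : Graph n m) where

  Joins : Fin m → Fin n → Fin n → Set
  Joins e u w = (G e ≡ (u , w)) ⊎ (G e ≡ (w , u))

  data Walk : Fin n → Fin n → Set where
    []   : ∀ {u} → Walk u u
    step : ∀ {u w v} (e : Fin m) → Joins e u w → Walk w v → Walk u v

  verts : ∀ {u v} → Walk u v → List (Fin n)
  verts {u} [] = u ∷ []
  verts {u} (step e _ p) = u ∷ verts p

  edgesW : ∀ {u v} → Walk u v → List (Fin m)
  edgesW [] = []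
  edgesW (step e _ p) = e ∷ edgesW p

  IsPath : ∀ {u v} → Walk u v → Set
  IsPath p = Unique (verts p)

  IsCircuit : ∀ {u} → Walk u u → Set
  IsCircuit [] = Data.Empty.⊥ where import Data.Empty
  IsCircuit (step e j p) = Unique (e ∷ edgesW p) × Unique (verts p)

  ind : Fin n → Fin n → ℕ
  ind u v = if does (u ≟ v) then 1 else 0

  degF : Subset m → Fin n → ℕ
  degF F v = sum (map (λ e → if lookup F e
                              then ind (proj₁ (G e)) v + ind (proj₂ (G e)) v
                              else 0) (allFin m))

  IsJoin : Subset n → Subset m → Set
  IsJoin T F = ∀ v → (degF F v % 2 ≡ 1 → v ∈ T) × (v ∈ T → degF F v % 2 ≡ 1)

  IsMinJoin : Subset n → Subset m → Set
  IsMinJoin T F = IsJoin T F × (∀ F' → IsJoin T F' → ∣ F ∣ ℕ.≤ ∣ F' ∣)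

wList : {m : ℕ} → Subset m → List (Fin m) → ℤ
wList F [] = + 0
wList F (e ∷ es) = (if lookup F e then -[1+ 0 ] else + 1) ℤ.+ wList F es

wF : ∀ {n m} (G : Graph n m) → Subset m → ∀ {u v} → Walk G u v → ℤ
wF G F p = wList F (edgesW G p)

IsLambda : ∀ {n m} (G : Graph n m) → Subset m → Fin n → Fin n → ℤ → Set
IsLambda G F x y l =
  (Σ[ P ∈ Walk G x y ] IsPath G P × wF G F P ≡ l)
  × (∀ (P : Walk G x y) → IsPath G P → l ℤ.≤ wF G F P)

IsExtreme : ∀ {n m} (G : Graph n m) → Subset m → Subset n → Set
IsExtreme G F X = ∀ x y → x ∈ X → y ∈ X → ∀ l → IsLambda G F x y l → + 0 ℤ.≤ l

IsMinLambda : ∀ {n m} (G : Graph n m) → Subset m → Subset n → Fin n → ℤ → Set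
IsMinLambda G F X y μ =
  (∃[ x ] x ∈ X × IsLambda G F x y μ)
  × (∀ x l → x ∈ X → IsLambda G F x y l → μ ℤ.≤ l)

-- The extension Ĝ of G: k new vertices (n ↑ʳ j) and l new edges,
-- new edge i joins the old vertex proj₁ (N i) to the new vertex proj₂ (N i).

extend : ∀ {n m k l} → Graph n m → (Fin l → Fin n × Fin k) → Graph (n + k) (m + l)
extend {n} {m} {k} {l} G N ê with splitAt m ê
... | inj₁ e = (proj₁ (G e) ↑ˡ k) , (proj₂ (G e) ↑ˡ k)
... | inj₂ i = (proj₁ (N i) ↑ˡ k) , n ↑ʳ proj₂ (N i)

extendF : ∀ {m} l → Subset m → Subset (m + l)
extendF l F = F ++ replicate l outside

OldIn : ∀ {n} k → Subset n → Fin (n + k) → Set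
OldIn k S v̂ = ∃[ v ] v ∈ S × v̂ ≡ v ↑ˡ k

InZhat : ∀ {n} k → Subset n → Fin (n + k) → Set
InZhat {n} k Z v̂ = OldIn k Z v̂ ⊎ (∃[ j ] v̂ ≡ n ↑ʳ j)

MeetsZhat : ∀ {n m k} (Ĝ : Graph (n + k) m) → Subset n → ∀ {a b} → Walk Ĝ a b → Set
MeetsZhat {k = k} Ĝ Z Q = ∃[ v ] v ∈ₗ verts Ĝ Q × InZhat k Z v

{-# OPTIONS --safe #-}
-- Cut a walk of Ĝ at its visits to X. Between two consecutive visits it runs through Y only or
-- through Ẑ only, since G has no Y–Z edges and the new vertices are adjacent only to X. A piece
-- through Y (or a single X–X edge) is a path of G between vertices of X, so extremality bounds
-- its weight below by 0; every edge at a vertex of Ẑ lies outside F, so a piece through Ẑ has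
-- positive weight. Adding up: an X–X path meeting Ẑ and a circuit through X meeting Ẑ (rotated
-- to start in X) have positive weight; a circuit avoiding X lies in Y, hence misses Ẑ, or lies
-- in Ẑ; an X–Z path ends, after its last visit to X, with a piece through Ẑ. In (ii) the part
-- of the path before its first visit to X is a Y–X path of G, of weight at least min λ, and the
-- rest is an X–X path meeting Ẑ.
module Submission where

open import Defs
open import Data.Nat as ℕ using (ℕ; zero; suc; _+_)
import Data.Nat.Properties as ℕ
open import Data.Integer as ℤ using (ℤ; +_; _≤_; _<_)
import Data.Integer.Properties as ℤ
open import Data.Fin as Fin using (Fin; _↑ˡ_; _↑ʳ_; splitAt)
import Data.Fin.Properties as Fin
open import Data.Fin.Subset using (Subset; _∈_; _∉_; _∪_; outside)
open import Data.Fin.Subset.Properties using (_∈?_; x∈p∪q⁺; x∈p∪q⁻)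
open import Data.Vec as Vec using (lookup; replicate)
import Data.Vec.Properties as Vec
open import Data.Bool using (true; false; if_then_else_)
open import Data.List as List using (List; []; _∷_; _++_)
open import Data.List.Relation.Unary.All as All using (All; []; _∷_)
import Data.List.Relation.Unary.All.Properties as All
open import Data.List.Relation.Unary.Any using (here; there; any?)
open import Data.List.Relation.Unary.Unique.Propositional using (Unique; []; _∷_)
import Data.List.Relation.Unary.Unique.Propositional.Properties as Unique
import Data.List.Relation.Unary.Unique.DecPropositional as DecUnique
open import Data.List.Relation.Binary.Disjoint.Propositional using (Disjoint)
open import Data.List.Relation.Binary.Permutation.Propositional using (↭-sym; ↭⇒↭ₛ)
open import Data.List.Relation.Binary.Permutation.Propositional.Properties using (↭-reverse)
import Data.List.Relation.Binary.Permutation.Setoid.Properties as Permutation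
open import Data.List.Membership.Propositional using (lose; find) renaming (_∈_ to _∈ₗ_)
open import Data.List.Membership.Propositional.Properties
  using (∈-++⁺ˡ; ∈-++⁺ʳ; ∈-++⁻; ∈-map⁺; ∈-concatMap⁺; ∈-lookup; ∈-allFin; ∈-filter⁺)
open import Data.List.Extrema ℤ.≤-totalOrder using (argmin; argmin-all; f[argmin]≤f[xs])
import Data.List.Properties as List
open import Data.Product using (Σ-syntax; _×_; _,_; proj₁; proj₂; ∃-syntax)
open import Data.Product.Properties using (≡-dec)
open import Data.Sum using (_⊎_; inj₁; inj₂; [_,_]′)
open import Data.Empty using (⊥; ⊥-elim)
open import Function using (_∘_; id)
open import Relation.Nullary using (¬_; Dec; yes; no; map′; _×-dec_)
open import Relation.Nullary.Decidable using (dec⇒maybe)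
open import Relation.Unary using (Pred; Decidable)
open import Relation.Binary.Definitions using (DecidableEquality)
open import Relation.Binary.PropositionalEquality
open import Level using (0ℓ)

Unique-++⁻ : ∀ {A : Set} (xs : List A) {ys} → Unique (xs ++ ys) → Unique xs × Unique ys × Disjoint xs ys
Unique-++⁻ [] u = [] , u , λ ()
Unique-++⁻ (x ∷ xs) (x∉ ∷ u) with Unique-++⁻ xs u
... | uxs , uys , disjoint = All.++⁻ˡ xs x∉ ∷ uxs , uys , λ where
  (here refl , v∈ys) → All.lookup (All.++⁻ʳ xs x∉) v∈ys refl
  (there v∈xs , v∈ys) → disjoint (v∈xs , v∈ys)

Unique-++-comm : ∀ {A : Set} (xs : List A) {ys} → Unique (xs ++ ys) → Unique (ys ++ xs)
Unique-++-comm xs u with Unique-++⁻ xs u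
... | uxs , uys , disjoint = Unique.++⁺ uys uxs (λ (v∈ys , v∈xs) → disjoint (v∈xs , v∈ys))

Unique-reverse : ∀ {A : Set} (xs : List A) → Unique xs → Unique (List.reverse xs)
Unique-reverse {A} xs = Permutation.Unique-resp-↭ (setoid A) (↭⇒↭ₛ (↭-sym (↭-reverse xs)))

lookup-injective : ∀ {A : Set} {xs : List A} → Unique xs →
                   ∀ {i j} → List.lookup xs i ≡ List.lookup xs j → i ≡ j
lookup-injective (_ ∷ _) {Fin.zero} {Fin.zero} _ = refl
lookup-injective (x∉ ∷ _) {Fin.zero} {Fin.suc j} eq = ⊥-elim (All.lookup x∉ (∈-lookup j) eq)
lookup-injective (x∉ ∷ _) {Fin.suc i} {Fin.zero} eq = ⊥-elim (All.lookup x∉ (∈-lookup i) (sym eq))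
lookup-injective (_ ∷ unique) {Fin.suc i} {Fin.suc j} eq = cong Fin.suc (lookup-injective unique eq)

Unique-length≤ : ∀ {n} (xs : List (Fin n)) → Unique xs → List.length xs ℕ.≤ n
Unique-length≤ {n} xs unique with List.length xs ℕ.≤? n
... | yes ≤n = ≤n
... | no ≰n with Fin.pigeonhole (ℕ.≰⇒> ≰n) (List.lookup xs)
... | i , j , i<j , eq = ⊥-elim (Fin.<⇒≢ i<j (lookup-injective unique eq))

-- Relies on K: every proof of a ≡ b is refl.
∈-decProof : ∀ {A : Set} {a b : A} (d : Dec (a ≡ b)) (eq : a ≡ b) → eq ∈ₗ List.fromMaybe (dec⇒maybe d)
∈-decProof (yes refl) refl = here refl
∈-decProof (no a≢b) eq = ⊥-elim (a≢b eq)

∈-concatMap-intro : ∀ {A B : Set} {f : A → List B} {x xs y} →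
                    x ∈ₗ xs → y ∈ₗ f x → y ∈ₗ List.concatMap f xs
∈-concatMap-intro {f = f} x∈ y∈ = ∈-concatMap⁺ f (lose x∈ y∈)

minimiser : ∀ {A : Set} (f : A → ℤ) {S : Pred A 0ℓ} (S? : Decidable S) (xs : List A) →
            (∀ {a} → S a → a ∈ₗ xs) → ∀ {a} → S a → Σ[ b ∈ A ] S b × (∀ {c} → S c → f b ≤ f c)
minimiser f S? xs complete {a} sa =
  argmin f a candidates ,
  argmin-all f sa (All.all-filter S? xs) ,
  λ sc → All.lookup (f[argmin]≤f[xs] a candidates) (∈-filter⁺ S? (complete sc) sc)
  where candidates = List.filter S? xs

edgeWeight : ∀ {m} → Subset m → Fin m → ℤ
edgeWeight F e = if lookup F e then ℤ.-[1+ 0 ] else + 1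

wList-++ : ∀ {m} (F : Subset m) es fs → wList F (es ++ fs) ≡ wList F es ℤ.+ wList F fs
wList-++ F [] fs = sym (ℤ.+-identityˡ _)
wList-++ F (e ∷ es) fs = begin
  edgeWeight F e ℤ.+ wList F (es ++ fs)           ≡⟨ cong (λ s → edgeWeight F e ℤ.+ s) (wList-++ F es fs) ⟩
  edgeWeight F e ℤ.+ (wList F es ℤ.+ wList F fs)  ≡⟨ ℤ.+-assoc (edgeWeight F e) _ _ ⟨
  (edgeWeight F e ℤ.+ wList F es) ℤ.+ wList F fs  ∎
  where open ≡-Reasoning

module Walks {n m : ℕ} (H : Graph n m) where

  infixr 5 _++ʷ_

  _++ʷ_ : ∀ {u v w} → Walk H u v → Walk H v w → Walk H u w
  [] ++ʷ q = q
  step e j p ++ʷ q = step e j (p ++ʷ q)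

  tailVerts : ∀ {u v} → Walk H u v → List (Fin n)
  tailVerts [] = []
  tailVerts (step e j p) = verts H p

  verts-∷ : ∀ {u v} (p : Walk H u v) → verts H p ≡ u ∷ tailVerts p
  verts-∷ [] = refl
  verts-∷ (step e j p) = refl

  end∈verts : ∀ {u v} (p : Walk H u v) → v ∈ₗ verts H p
  end∈verts [] = here refl
  end∈verts (step e j p) = there (end∈verts p)

  edgesW-++ʷ : ∀ {u v w} (p : Walk H u v) (q : Walk H v w) → edgesW H (p ++ʷ q) ≡ edgesW H p ++ edgesW H q
  edgesW-++ʷ [] q = refl
  edgesW-++ʷ (step e j p) q = cong (e ∷_) (edgesW-++ʷ p q)

  verts-++ʷ : ∀ {u v w} (p : Walk H u v) (q : Walk H v w) → verts H (p ++ʷ q) ≡ verts H p ++ tailVerts q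
  verts-++ʷ [] q = verts-∷ q
  verts-++ʷ {u} (step e j p) q = cong (u ∷_) (verts-++ʷ p q)

  tailVerts-++ʷ : ∀ {u v w} (p : Walk H u v) (q : Walk H v w) → tailVerts (p ++ʷ q) ≡ tailVerts p ++ tailVerts q
  tailVerts-++ʷ [] q = refl
  tailVerts-++ʷ (step e j p) q = verts-++ʷ p q

  wF-++ʷ : ∀ (F : Subset m) {u v w} (p : Walk H u v) (q : Walk H v w) → wF H F (p ++ʷ q) ≡ wF H F p ℤ.+ wF H F q
  wF-++ʷ F p q rewrite edgesW-++ʷ p q = wList-++ F (edgesW H p) (edgesW H q)

  wF-++ʷ-comm : ∀ (F : Subset m) {u v} (p : Walk H u v) (q : Walk H v u) → wF H F (p ++ʷ q) ≡ wF H F (q ++ʷ p)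
  wF-++ʷ-comm F p q = begin
    wF H F (p ++ʷ q)         ≡⟨ wF-++ʷ F p q ⟩
    wF H F p ℤ.+ wF H F q    ≡⟨ ℤ.+-comm (wF H F p) _ ⟩
    wF H F q ℤ.+ wF H F p    ≡⟨ wF-++ʷ F q p ⟨
    wF H F (q ++ʷ p)         ∎
    where open ≡-Reasoning

  Unique-tailVerts-++ʷ-comm : ∀ {u v} (p : Walk H u v) (q : Walk H v u) →
                              Unique (tailVerts (p ++ʷ q)) → Unique (tailVerts (q ++ʷ p))
  Unique-tailVerts-++ʷ-comm p q unique rewrite tailVerts-++ʷ p q | tailVerts-++ʷ q p =
    Unique-++-comm (tailVerts p) unique

  ∈-verts-++ʷ⁻ : ∀ {u v w x} (p : Walk H u v) (q : Walk H v w) →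
                 x ∈ₗ verts H (p ++ʷ q) → x ∈ₗ verts H p ⊎ x ∈ₗ verts H q
  ∈-verts-++ʷ⁻ p q x∈ rewrite verts-++ʷ p q | verts-∷ q with ∈-++⁻ (verts H p) x∈
  ... | inj₁ x∈p = inj₁ x∈p
  ... | inj₂ x∈q = inj₂ (there x∈q)

  ∈-verts-++ʷ⁺ʳ : ∀ {u v w x} (p : Walk H u v) (q : Walk H v w) →
                  x ∈ₗ verts H q → x ∈ₗ verts H (p ++ʷ q)
  ∈-verts-++ʷ⁺ʳ p q x∈ rewrite verts-++ʷ p q | verts-∷ q with x∈
  ... | here refl = ∈-++⁺ˡ (end∈verts p)
  ... | there x∈′ = ∈-++⁺ʳ (verts H p) x∈′

  ∈-verts-++ʷ⁺ˡ : ∀ {u v w x} (p : Walk H u v) (q : Walk H v w) →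
                  x ∈ₗ verts H p → x ∈ₗ verts H (p ++ʷ q)
  ∈-verts-++ʷ⁺ˡ p q x∈ rewrite verts-++ʷ p q = ∈-++⁺ˡ x∈

  IsPath-++ʷ⁻ : ∀ {u v w} (p : Walk H u v) (q : Walk H v w) → IsPath H (p ++ʷ q) → IsPath H p × IsPath H q
  IsPath-++ʷ⁻ p q path rewrite verts-++ʷ p q with Unique-++⁻ (verts H p) path
  ... | up , uq , disjoint rewrite verts-∷ q =
    up , All.¬Any⇒All¬ _ (λ v∈q → disjoint (end∈verts p , v∈q)) ∷ uq

  IsPath-closed : ∀ {x y} (p : Walk H x y) (q : Walk H y x) → y ∈ₗ tailVerts p → x ∈ₗ tailVerts q →
                  Unique (tailVerts (p ++ʷ q)) → IsPath H p × IsPath H q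
  IsPath-closed p q y∈p x∈q unique rewrite tailVerts-++ʷ p q | verts-∷ p | verts-∷ q
    with Unique-++⁻ (tailVerts p) unique
  ... | up , uq , disjoint =
    All.¬Any⇒All¬ _ (λ x∈p → disjoint (x∈p , x∈q)) ∷ up ,
    All.¬Any⇒All¬ _ (λ y∈q → disjoint (y∈p , y∈q)) ∷ uq

  split-at : ∀ {u v x} (p : Walk H u v) → x ∈ₗ verts H p →
             Σ[ A ∈ Walk H u x ] Σ[ B ∈ Walk H x v ] p ≡ A ++ʷ B
  split-at [] (here refl) = [] , [] , refl
  split-at (step e j p) (here refl) = [] , step e j p , refl
  split-at (step e j p) (there x∈) with split-at p x∈
  ... | A , B , refl = step e j A , B , refl

  Joins-sym : ∀ {e u w} → Joins H e u w → Joins H e w u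
  Joins-sym (inj₁ eq) = inj₂ eq
  Joins-sym (inj₂ eq) = inj₁ eq

  reverse : ∀ {u v} → Walk H u v → Walk H v u
  reverse [] = []
  reverse (step e j p) = reverse p ++ʷ step e (Joins-sym j) []

  verts-reverse : ∀ {u v} (p : Walk H u v) → verts H (reverse p) ≡ List.reverse (verts H p)
  verts-reverse [] = refl
  verts-reverse {u} (step e j p) = begin
    verts H (reverse p ++ʷ step e (Joins-sym j) [])   ≡⟨ verts-++ʷ (reverse p) _ ⟩
    verts H (reverse p) ++ u ∷ []                     ≡⟨ cong (_++ u ∷ []) (verts-reverse p) ⟩
    List.reverse (verts H p) ++ u ∷ []                ≡⟨ List.unfold-reverse u (verts H p) ⟨
    List.reverse (u ∷ verts H p)                      ∎
    where open ≡-Reasoning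

  IsPath-reverse : ∀ {u v} (p : Walk H u v) → IsPath H p → IsPath H (reverse p)
  IsPath-reverse p path = subst Unique (sym (verts-reverse p)) (Unique-reverse (verts H p) path)

  wF-reverse : ∀ (F : Subset m) {u v} (p : Walk H u v) → wF H F (reverse p) ≡ wF H F p
  wF-reverse F [] = refl
  wF-reverse F (step e j p) = begin
    wF H F (reverse p ++ʷ step e (Joins-sym j) [])   ≡⟨ wF-++ʷ F (reverse p) _ ⟩
    wF H F (reverse p) ℤ.+ (edgeWeight F e ℤ.+ + 0)  ≡⟨ cong₂ ℤ._+_ (wF-reverse F p) (ℤ.+-identityʳ _) ⟩
    wF H F p ℤ.+ edgeWeight F e                      ≡⟨ ℤ.+-comm (wF H F p) _ ⟩
    edgeWeight F e ℤ.+ wF H F p                      ∎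
    where open ≡-Reasoning

  Meets : Pred (Fin n) 0ℓ → ∀ {u v} → Walk H u v → Set
  Meets M p = ∃[ v ] v ∈ₗ verts H p × M v

  module _ {M : Pred (Fin n) 0ℓ} where

    All¬⇒¬Meets : ∀ {u v} (p : Walk H u v) → All (¬_ ∘ M) (verts H p) → ¬ Meets M p
    All¬⇒¬Meets _ none (v , v∈ , mv) = All.lookup none v∈ mv

    Meets-++ʷ⁻ : ∀ {u v w} (p : Walk H u v) (q : Walk H v w) → Meets M (p ++ʷ q) → Meets M p ⊎ Meets M q
    Meets-++ʷ⁻ p q (v , v∈ , mv) with ∈-verts-++ʷ⁻ p q v∈
    ... | inj₁ v∈p = inj₁ (v , v∈p , mv)
    ... | inj₂ v∈q = inj₂ (v , v∈q , mv)

    Meets-++ʷ-comm : ∀ {u v} (p : Walk H u v) (q : Walk H v u) → Meets M (p ++ʷ q) → Meets M (q ++ʷ p)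
    Meets-++ʷ-comm p q meets with Meets-++ʷ⁻ p q meets
    ... | inj₁ (v , v∈p , mv) = v , ∈-verts-++ʷ⁺ʳ q p v∈p , mv
    ... | inj₂ (v , v∈q , mv) = v , ∈-verts-++ʷ⁺ˡ q p v∈q , mv

  data AllInit (P : Pred (Fin n) 0ℓ) : ∀ {u v} → Walk H u v → Set where
    []  : ∀ {u} → AllInit P ([] {u = u})
    _∷_ : ∀ {u w v e} {j : Joins H e u w} {p : Walk H w v} → P u → AllInit P p → AllInit P (step e j p)

  module _ {P : Pred (Fin n) 0ℓ} where

    All⇒AllInit : ∀ {u v} {p : Walk H u v} → All P (verts H p) → AllInit P p
    All⇒AllInit {p = []} _ = []
    All⇒AllInit {p = step e j p} (pu ∷ ps) = pu ∷ All⇒AllInit ps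

    AllInit⇒All : ∀ {u v} {p : Walk H u v} → AllInit P p → P v → All P (verts H p)
    AllInit⇒All [] pv = pv ∷ []
    AllInit⇒All (pu ∷ ps) pv = pu ∷ AllInit⇒All ps pv

    AllInit-map : ∀ {Q : Pred (Fin n) 0ℓ} → (∀ {v} → P v → Q v) →
                  ∀ {u v} {p : Walk H u v} → AllInit P p → AllInit Q p
    AllInit-map f [] = []
    AllInit-map f (pu ∷ ps) = f pu ∷ AllInit-map f ps

    AllInit-propagate : ∀ {R : Pred (Fin n) 0ℓ} → (∀ {e a b} → Joins H e a b → R a → P b → R b) →
                        ∀ {u v} {p : Walk H u v} → R u → AllInit P p → AllInit R p
    AllInit-propagate closed ru [] = []
    AllInit-propagate closed ru (_ ∷ []) = ru ∷ []
    AllInit-propagate closed ru (_∷_ {j = j} _ ps@(pw ∷ _)) = ru ∷ AllInit-propagate closed (closed j ru pw) ps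

  module Segmentation {P : Pred (Fin n) 0ℓ} (P? : Decidable P) where

    data IsSegment : ∀ {x y} → Walk H x y → Set where
      segment : ∀ {x w y e} {j : Joins H e x w} {A : Walk H w y} →
                P x → AllInit (¬_ ∘ P) A → P y → IsSegment (step e j A)

    data Segments : ∀ {x y} → Walk H x y → Set where
      []  : ∀ {x} → P x → Segments ([] {u = x})
      _∷_ : ∀ {x y z} {S : Walk H x y} {B : Walk H y z} → IsSegment S → Segments B → Segments (S ++ʷ B)

    Segments-start : ∀ {x y} {Q : Walk H x y} → Segments Q → P x
    Segments-start ([] px) = px
    Segments-start (segment px _ _ ∷ _) = px

    data Decomposition : ∀ {u y} → Walk H u y → Set where
      decomposition : ∀ {u x y} {A : Walk H u x} {B : Walk H x y} →
                      AllInit (¬_ ∘ P) A → Segments B → Decomposition (A ++ʷ B)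

    decompose : ∀ {u y} → P y → (Q : Walk H u y) → Decomposition Q
    decompose py [] = decomposition [] ([] py)
    decompose py (step {u} e j Q) with decompose py Q | P? u
    ... | decomposition approach segments | yes pu =
          decomposition [] (segment pu approach (Segments-start segments) ∷ segments)
    ... | decomposition approach segments | no ¬pu = decomposition (¬pu ∷ approach) segments

    segmentsFrom : ∀ {x y} {Q : Walk H x y} → P x → Decomposition Q → Segments Q
    segmentsFrom px (decomposition [] segments) = segments
    segmentsFrom px (decomposition (¬px ∷ _) _) = ⊥-elim (¬px px)

    IsSegment-end∈tail : ∀ {x y} {S : Walk H x y} → IsSegment S → y ∈ₗ tailVerts S
    IsSegment-end∈tail (segment {A = A} _ _ _) = end∈verts A

    module SegmentWeights (F : Subset m) {M : Pred (Fin n) 0ℓ} (P⇒¬M : ∀ {v} → P v → ¬ M v)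
      (segment-nonneg : ∀ {x y} {S : Walk H x y} → IsSegment S → IsPath H S → + 0 ≤ wF H F S)
      (segment-pos : ∀ {x y} {S : Walk H x y} → IsSegment S → Meets M S → + 0 < wF H F S) where

      segments-nonneg : ∀ {x y} {Q : Walk H x y} → Segments Q → IsPath H Q → + 0 ≤ wF H F Q
      segments-nonneg ([] _) _ = ℤ.≤-refl
      segments-nonneg (_∷_ {S = S} {B} s segs) path =
        let pS , pB = IsPath-++ʷ⁻ S B path in
        subst (+ 0 ≤_) (sym (wF-++ʷ F S B)) (ℤ.+-mono-≤ (segment-nonneg s pS) (segments-nonneg segs pB))

      segments-pos : ∀ {x y} {Q : Walk H x y} → Segments Q → IsPath H Q → Meets M Q → + 0 < wF H F Q
      segment∷segments-pos : ∀ {x y z} {S : Walk H x y} {B : Walk H y z} → IsSegment S → Segments B →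
                             IsPath H S → IsPath H B → Meets M (S ++ʷ B) → + 0 < wF H F (S ++ʷ B)

      segments-pos ([] px) _ meets = ⊥-elim (All¬⇒¬Meets [] (P⇒¬M px ∷ []) meets)
      segments-pos (_∷_ {S = S} {B} s segs) path =
        let pS , pB = IsPath-++ʷ⁻ S B path in segment∷segments-pos s segs pS pB

      segment∷segments-pos {S = S} {B} s segs pS pB meets =
        subst (+ 0 <_) (sym (wF-++ʷ F S B)) (bound (Meets-++ʷ⁻ S B meets))
        where
        bound : Meets M S ⊎ Meets M B → + 0 < wF H F S ℤ.+ wF H F B
        bound (inj₁ mS) = ℤ.+-mono-<-≤ (segment-pos s mS) (segments-nonneg segs pB)
        bound (inj₂ mB) = ℤ.+-mono-≤-< (segment-nonneg s pS) (segments-pos segs pB mB)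

      closed-segments-pos : ∀ {x} {C : Walk H x x} → Segments C → Unique (tailVerts C) → Meets M C →
                            + 0 < wF H F C
      closed-segments-pos ([] px) _ meets = ⊥-elim (All¬⇒¬Meets [] (P⇒¬M px ∷ []) meets)
      closed-segments-pos (_∷_ {S = S} s ([] px)) _ meets with Meets-++ʷ⁻ S [] meets
      ... | inj₁ mS = subst (+ 0 <_) (sym (wF-++ʷ F S [])) (ℤ.+-mono-<-≤ (segment-pos s mS) ℤ.≤-refl)
      ... | inj₂ m[] = ⊥-elim (All¬⇒¬Meets [] (P⇒¬M px ∷ []) m[])
      closed-segments-pos (_∷_ {S = S} s segs@(_∷_ {B = B} (segment {A = A} _ _ _) _)) unique =
        let pS , pB = IsPath-closed S _ (IsSegment-end∈tail s) (end∈verts (A ++ʷ B)) unique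
        in segment∷segments-pos s segs pS pB

-- λ and μ are specified relationally, so their existence needs an exhaustive search; it is
-- complete because a path has fewer than n edges.
module Enumeration {n m : ℕ} (H : Graph n m) where

  private
    _≟₂_ : DecidableEquality (Fin n × Fin n)
    _≟₂_ = ≡-dec Fin._≟_ Fin._≟_

  joinings : ∀ e u w → List (Joins H e u w)
  joinings e u w = List.map inj₁ (List.fromMaybe (dec⇒maybe (H e ≟₂ (u , w))))
                ++ List.map inj₂ (List.fromMaybe (dec⇒maybe (H e ≟₂ (w , u))))

  ∈-joinings : ∀ {e u w} (j : Joins H e u w) → j ∈ₗ joinings e u w
  ∈-joinings {e} {u} {w} (inj₁ eq) = ∈-++⁺ˡ (∈-map⁺ inj₁ (∈-decProof (H e ≟₂ (u , w)) eq))
  ∈-joinings {e} {u} {w} (inj₂ eq) = ∈-++⁺ʳ _ (∈-map⁺ inj₂ (∈-decProof (H e ≟₂ (w , u)) eq))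

  trivialWalks : ∀ u v → List (Walk H u v)
  trivialWalks u v with u Fin.≟ v
  ... | yes refl = [] ∷ []
  ... | no _ = []

  []∈trivialWalks : ∀ u → [] ∈ₗ trivialWalks u u
  []∈trivialWalks u with u Fin.≟ u
  ... | yes refl = here refl
  ... | no u≢u = ⊥-elim (u≢u refl)

  walks : ℕ → ∀ u v → List (Walk H u v)
  walks zero u v = trivialWalks u v
  walks (suc d) u v = trivialWalks u v ++ List.concatMap (λ e → List.concatMap (λ w →
    List.concatMap (λ j → List.map (step e j) (walks d w v)) (joinings e u w)) (List.allFin n)) (List.allFin m)

  ∈-walks : ∀ d {u v} (p : Walk H u v) → List.length (edgesW H p) ℕ.≤ d → p ∈ₗ walks d u v
  ∈-walks zero [] _ = []∈trivialWalks _
  ∈-walks (suc d) [] _ = ∈-++⁺ˡ ([]∈trivialWalks _)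
  ∈-walks (suc d) {u} {v} (step {w = w} e j p) (ℕ.s≤s len) =
    ∈-++⁺ʳ (trivialWalks u v) (∈-concatMap-intro (∈-allFin e) (∈-concatMap-intro (∈-allFin w)
      (∈-concatMap-intro (∈-joinings j) (∈-map⁺ (step e j) (∈-walks d p len)))))

  length-verts : ∀ {u v} (p : Walk H u v) → List.length (verts H p) ≡ suc (List.length (edgesW H p))
  length-verts [] = refl
  length-verts (step e j p) = cong suc (length-verts p)

  path∈walks : ∀ {u v} {p : Walk H u v} → IsPath H p → p ∈ₗ walks n u v
  path∈walks {p = p} path =
    ∈-walks n p (ℕ.<⇒≤ (subst (ℕ._≤ n) (length-verts p) (Unique-length≤ (verts H p) path)))

  isPath? : ∀ {u v} → Decidable (IsPath H {u} {v})
  isPath? p = DecUnique.unique? Fin._≟_ (verts H p)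

  module _ (F : Subset m) where

    λ-exists : ∀ {x y} (p : Walk H x y) → IsPath H p → Σ[ l ∈ ℤ ] IsLambda H F x y l × l ≤ wF H F p
    λ-exists p path with minimiser (wF H F) isPath? (walks n _ _) path∈walks path
    ... | b , path-b , least = wF H F b , ((b , path-b , refl) , λ _ → least) , least path

    μ-exists : ∀ {X : Subset n} {x y} → x ∈ X → (p : Walk H x y) → IsPath H p →
               Σ[ μ ∈ ℤ ] IsMinLambda H F X y μ × μ ≤ wF H F p
    μ-exists {X} {x} {y} x∈X p path with minimiser (wF H F ∘ proj₂) candidate? candidates complete (x∈X , path)
      where
      candidate? : Decidable (λ (c : Σ[ x ∈ Fin n ] Walk H x y) → proj₁ c ∈ X × IsPath H (proj₂ c))
      candidate? (x , p) = x ∈? X ×-dec isPath? p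
      candidates = List.concatMap (λ x → List.map (x ,_) (walks n x y)) (List.allFin n)
      complete : ∀ {c} → proj₁ c ∈ X × IsPath H (proj₂ c) → c ∈ₗ candidates
      complete {x , p} (_ , path) = ∈-concatMap-intro (∈-allFin x) (∈-map⁺ (x ,_) (path∈walks path))
    ... | (x* , b) , (x*∈X , path-b) , least =
          wF H F b ,
          ((x* , x*∈X , (b , path-b , refl) , λ _ path-P → least (x*∈X , path-P)) ,
           λ { _ _ x∈X ((_ , path-P , refl) , _) → least (x∈X , path-P) }) ,
          least (x∈X , path)

data SplitView (a b : ℕ) : Fin (a + b) → Set where
  left  : (i : Fin a) → SplitView a b (i ↑ˡ b)
  right : (j : Fin b) → SplitView a b (a ↑ʳ j)

splitView : ∀ a b (i : Fin (a + b)) → SplitView a b i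
splitView a b i with splitAt a i in eq
... | inj₁ i′ = subst (SplitView a b) (Fin.splitAt⁻¹-↑ˡ eq) (left i′)
... | inj₂ j = subst (SplitView a b) (Fin.splitAt⁻¹-↑ʳ eq) (right j)

↑ˡ≢↑ʳ : ∀ {a b} (i : Fin a) (j : Fin b) → i ↑ˡ b ≢ a ↑ʳ j
↑ˡ≢↑ʳ {a} {b} i j eq
  with trans (sym (Fin.splitAt-↑ˡ a i b)) (trans (cong (splitAt a) eq) (Fin.splitAt-↑ʳ a b j))
... | ()

module _ {n} (k : ℕ) {S : Subset n} where

  OldIn-↑ˡ⁻ : ∀ {v} → OldIn k S (v ↑ˡ k) → v ∈ S
  OldIn-↑ˡ⁻ {v} (v′ , v′∈S , eq) = subst (_∈ S) (Fin.↑ˡ-injective k v′ v (sym eq)) v′∈S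

  ¬OldIn-↑ʳ : ∀ {j} → ¬ OldIn k S (n ↑ʳ j)
  ¬OldIn-↑ʳ {j} (v , _ , eq) = ↑ˡ≢↑ʳ v j (sym eq)

  OldIn? : Decidable (OldIn k S)
  OldIn? v̂ with splitView n k v̂
  ... | left v = map′ (λ v∈S → v , v∈S , refl) OldIn-↑ˡ⁻ (v ∈? S)
  ... | right j = no ¬OldIn-↑ʳ

module Extension {n m : ℕ} (G : Graph n m) (F : Subset m) (X Y Z : Subset n)
  (extreme : IsExtreme G F X)
  (Y-disjoint-Z : ∀ v → v ∈ Y → v ∈ Z → ⊥)
  (XYZ-cover : ∀ v → v ∉ X → v ∈ Y ⊎ v ∈ Z)
  (X-disjoint-YZ : ∀ v → v ∈ Y ⊎ v ∈ Z → v ∉ X)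
  (YZ-edgeless : ∀ e → (proj₁ (G e) ∈ Y → proj₂ (G e) ∈ Z → ⊥) × (proj₁ (G e) ∈ Z → proj₂ (G e) ∈ Y → ⊥))
  (F-avoids-Z : ∀ e → e ∈ F → proj₁ (G e) ∉ Z × proj₂ (G e) ∉ Z)
  {k l : ℕ} (N : Fin l → Fin n × Fin k)
  (N-from-X : ∀ i → proj₁ (N i) ∈ X) where

  Ĝ : Graph (n + k) (m + l)
  Ĝ = extend G N

  F̂ : Subset (m + l)
  F̂ = extendF l F

  w : ∀ {a b} → Walk Ĝ a b → ℤ
  w = wF Ĝ F̂

  open Walks Ĝ

  ι : Fin n → Fin (n + k)
  ι v = v ↑ˡ k

  X̂ Ŷ Ẑ X̂∪Ŷ : Pred (Fin (n + k)) 0ℓ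
  X̂ = OldIn k X
  Ŷ = OldIn k Y
  Ẑ = InZhat k Z
  X̂∪Ŷ = OldIn k (X ∪ Y)

  classify : ∀ v̂ → X̂ v̂ ⊎ Ŷ v̂ ⊎ Ẑ v̂
  classify v̂ with splitView n k v̂
  ... | right j = inj₂ (inj₂ (inj₂ (j , refl)))
  ... | left v with v ∈? X
  ... | yes v∈X = inj₁ (v , v∈X , refl)
  ... | no v∉X with XYZ-cover v v∉X
  ... | inj₁ v∈Y = inj₂ (inj₁ (v , v∈Y , refl))
  ... | inj₂ v∈Z = inj₂ (inj₂ (inj₁ (v , v∈Z , refl)))

  X̂⇒X̂∪Ŷ : ∀ {v̂} → X̂ v̂ → X̂∪Ŷ v̂
  X̂⇒X̂∪Ŷ (v , v∈X , eq) = v , x∈p∪q⁺ (inj₁ v∈X) , eq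

  Ŷ⇒X̂∪Ŷ : ∀ {v̂} → Ŷ v̂ → X̂∪Ŷ v̂
  Ŷ⇒X̂∪Ŷ (v , v∈Y , eq) = v , x∈p∪q⁺ (inj₂ v∈Y) , eq

  X̂∪Ŷ⇒¬Ẑ : ∀ {v̂} → X̂∪Ŷ v̂ → ¬ Ẑ v̂
  X̂∪Ŷ⇒¬Ẑ (v , v∈X∪Y , refl) (inj₂ (j , eq)) = ↑ˡ≢↑ʳ v j eq
  X̂∪Ŷ⇒¬Ẑ (v , v∈X∪Y , refl) (inj₁ z) with OldIn-↑ˡ⁻ k z | x∈p∪q⁻ X Y v∈X∪Y
  ... | v∈Z | inj₁ v∈X = X-disjoint-YZ v (inj₂ v∈Z) v∈X
  ... | v∈Z | inj₂ v∈Y = Y-disjoint-Z v v∈Y v∈Z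

  X̂⇒¬Ẑ : ∀ {v̂} → X̂ v̂ → ¬ Ẑ v̂
  X̂⇒¬Ẑ = X̂∪Ŷ⇒¬Ẑ ∘ X̂⇒X̂∪Ŷ

  extend-↑ˡ : ∀ e → Ĝ (e ↑ˡ l) ≡ (ι (proj₁ (G e)) , ι (proj₂ (G e)))
  extend-↑ˡ e rewrite Fin.splitAt-↑ˡ m e l = refl

  extend-↑ʳ : ∀ i → Ĝ (m ↑ʳ i) ≡ (ι (proj₁ (N i)) , n ↑ʳ proj₂ (N i))
  extend-↑ʳ i rewrite Fin.splitAt-↑ʳ m l i = refl

  weight-↑ˡ : ∀ e → edgeWeight F̂ (e ↑ˡ l) ≡ edgeWeight F e
  weight-↑ˡ e = cong (λ b → if b then ℤ.-[1+ 0 ] else + 1) (Vec.lookup-++ˡ F (replicate l outside) e)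

  weight-↑ʳ : ∀ i → edgeWeight F̂ (m ↑ʳ i) ≡ + 1
  weight-↑ʳ i = cong (λ b → if b then ℤ.-[1+ 0 ] else + 1)
                     (trans (Vec.lookup-++ʳ F (replicate l outside) i) (Vec.lookup-replicate i outside))

  data ĜJoins : Fin (m + l) → Fin (n + k) → Fin (n + k) → Set where
    old  : ∀ {e a b} → Joins G e a b → ĜJoins (e ↑ˡ l) (ι a) (ι b)
    new  : ∀ i → ĜJoins (m ↑ʳ i) (ι (proj₁ (N i))) (n ↑ʳ proj₂ (N i))
    new⁻ : ∀ i → ĜJoins (m ↑ʳ i) (n ↑ʳ proj₂ (N i)) (ι (proj₁ (N i)))

  joins-view : ∀ {ê a b} → Joins Ĝ ê a b → ĜJoins ê a b
  joins-view {ê} j with splitView m l ê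
  joins-view (inj₁ eq) | left e with trans (sym (extend-↑ˡ e)) eq
  ... | refl = old (inj₁ refl)
  joins-view (inj₂ eq) | left e with trans (sym (extend-↑ˡ e)) eq
  ... | refl = old (inj₂ refl)
  joins-view (inj₁ eq) | right i with trans (sym (extend-↑ʳ i)) eq
  ... | refl = new i
  joins-view (inj₂ eq) | right i with trans (sym (extend-↑ʳ i)) eq
  ... | refl = new⁻ i

  ¬Joins-YZ : ∀ {e a b} → Joins G e a b → a ∈ Y → b ∈ Z → ⊥
  ¬Joins-YZ {e} (inj₁ refl) = proj₁ (YZ-edgeless e)
  ¬Joins-YZ {e} (inj₂ refl) a∈Y b∈Z = proj₂ (YZ-edgeless e) b∈Z a∈Y

  ¬ĜJoins-ŶẐ : ∀ {ê a b} → ĜJoins ê a b → Ŷ a → Ẑ b → ⊥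
  ¬ĜJoins-ŶẐ (old j) ŷ (inj₁ z) = ¬Joins-YZ j (OldIn-↑ˡ⁻ k ŷ) (OldIn-↑ˡ⁻ k z)
  ¬ĜJoins-ŶẐ (old {b = b} j) ŷ (inj₂ (i , eq)) = ↑ˡ≢↑ʳ b i eq
  ¬ĜJoins-ŶẐ (new i) ŷ _ = X-disjoint-YZ _ (inj₁ (OldIn-↑ˡ⁻ k ŷ)) (N-from-X i)
  ¬ĜJoins-ŶẐ (new⁻ i) ŷ _ = ¬OldIn-↑ʳ k ŷ

  Joins-Z-weight : ∀ {e a b} → Joins G e a b → a ∈ Z → edgeWeight F e ≡ + 1
  Joins-Z-weight {e} j a∈Z with lookup F e in e∈F?
  ... | false = refl
  ... | true with F-avoids-Z e (Vec.lookup⇒[]= e F e∈F?) | j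
  ...   | G₁∉Z , _ | inj₁ refl = ⊥-elim (G₁∉Z a∈Z)
  ...   | _ , G₂∉Z | inj₂ refl = ⊥-elim (G₂∉Z a∈Z)

  ĜJoins-Ẑ-weight : ∀ {ê a b} → ĜJoins ê a b → Ẑ a → edgeWeight F̂ ê ≡ + 1
  ĜJoins-Ẑ-weight (old {e} j) (inj₁ z) = trans (weight-↑ˡ e) (Joins-Z-weight j (OldIn-↑ˡ⁻ k z))
  ĜJoins-Ẑ-weight (old {a = a} j) (inj₂ (i , eq)) = ⊥-elim (↑ˡ≢↑ʳ a i eq)
  ĜJoins-Ẑ-weight (new i) _ = weight-↑ʳ i
  ĜJoins-Ẑ-weight (new⁻ i) _ = weight-↑ʳ i

  Ẑ-edge-weight : ∀ {ê a b} → Joins Ĝ ê a b → Ẑ a → edgeWeight F̂ ê ≡ + 1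
  Ẑ-edge-weight = ĜJoins-Ẑ-weight ∘ joins-view

  Ŷ-closed : ∀ {ê a b} → Joins Ĝ ê a b → Ŷ a → ¬ X̂ b → Ŷ b
  Ŷ-closed {b = b} j ŷ ¬x̂ with classify b
  ... | inj₁ x̂ = ⊥-elim (¬x̂ x̂)
  ... | inj₂ (inj₁ ŷ′) = ŷ′
  ... | inj₂ (inj₂ ẑ) = ⊥-elim (¬ĜJoins-ŶẐ (joins-view j) ŷ ẑ)

  Ẑ-closed : ∀ {ê a b} → Joins Ĝ ê a b → Ẑ a → ¬ X̂ b → Ẑ b
  Ẑ-closed {b = b} j ẑ ¬x̂ with classify b
  ... | inj₁ x̂ = ⊥-elim (¬x̂ x̂)
  ... | inj₂ (inj₁ ŷ) = ⊥-elim (¬ĜJoins-ŶẐ (joins-view (Joins-sym j)) ŷ ẑ)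
  ... | inj₂ (inj₂ ẑ′) = ẑ′

  step-pos : ∀ {ê a b c} (j : Joins Ĝ ê a b) (p : Walk Ĝ b c) →
             edgeWeight F̂ ê ≡ + 1 → + 0 ≤ w p → + 0 < w (step ê j p)
  step-pos j p weight≡1 w≥0 rewrite weight≡1 = ℤ.+-mono-<-≤ (ℤ.+<+ (ℕ.s≤s ℕ.z≤n)) w≥0

  Ẑ-walk-nonneg : ∀ {a b} {p : Walk Ĝ a b} → AllInit Ẑ p → + 0 ≤ w p
  Ẑ-walk-pos : ∀ {ê a b c} {j : Joins Ĝ ê a b} {p : Walk Ĝ b c} →
               AllInit Ẑ (step ê j p) → + 0 < w (step ê j p)

  Ẑ-walk-nonneg [] = ℤ.≤-refl
  Ẑ-walk-nonneg inner@(_ ∷ _) = ℤ.<⇒≤ (Ẑ-walk-pos inner)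

  Ẑ-walk-pos {j = j} {p} (ẑ ∷ inner) = step-pos j p (Ẑ-edge-weight j ẑ) (Ẑ-walk-nonneg inner)

  record Lift {â b̂} (Q : Walk Ĝ â b̂) : Set where
    constructor lifting
    field
      {start end} : Fin n
      walk : Walk G start end
      start≡ : â ≡ ι start
      end≡ : b̂ ≡ ι end
      verts≡ : verts Ĝ Q ≡ List.map ι (verts G walk)
      weight≡ : w Q ≡ wF G F walk

  lift : ∀ {â b̂} (Q : Walk Ĝ â b̂) → All X̂∪Ŷ (verts Ĝ Q) → Lift Q
  lift [] ((v , _ , refl) ∷ []) = lifting [] refl refl refl refl
  lift (step ê j Q) (o ∷ rest) with joins-view j | lift Q rest
  ... | old {e} {a} {b} jG | lifting P start≡ end≡ verts≡ weight≡ with Fin.↑ˡ-injective k b _ start≡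
  ...   | refl = lifting (step e jG P) refl end≡ (cong (ι a ∷_) verts≡) (cong₂ ℤ._+_ (weight-↑ˡ e) weight≡)
  lift (step ê j Q) (o ∷ rest) | new i | lifting _ start≡ _ _ _ = ⊥-elim (↑ˡ≢↑ʳ _ _ (sym start≡))
  lift (step ê j Q) (o ∷ rest) | new⁻ i | _ = ⊥-elim (¬OldIn-↑ʳ k o)

  lift-path : ∀ {a b} (Q : Walk Ĝ (ι a) (ι b)) → All X̂∪Ŷ (verts Ĝ Q) → IsPath Ĝ Q →
              Σ[ P ∈ Walk G a b ] IsPath G P × wF G F P ≡ w Q
  lift-path {a} {b} Q in-XY path with lift Q in-XY
  ... | lifting P start≡ end≡ verts≡ weight≡
    with Fin.↑ˡ-injective k a _ start≡ | Fin.↑ˡ-injective k b _ end≡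
  ... | refl | refl = P , Unique.map⁻ (subst Unique verts≡ path) , sym weight≡

  X̂∪Ŷ-path-nonneg : ∀ {a b} (Q : Walk Ĝ a b) → X̂ a → X̂ b → All X̂∪Ŷ (verts Ĝ Q) → IsPath Ĝ Q →
                    + 0 ≤ w Q
  X̂∪Ŷ-path-nonneg Q (a , a∈X , refl) (b , b∈X , refl) in-XY path with lift-path Q in-XY path
  ... | P , path-P , weight≡ with Enumeration.λ-exists G F P path-P
  ... | l , isλ , l≤w = subst (+ 0 ≤_) weight≡ (ℤ.≤-trans (extreme a b a∈X b∈X l isλ) l≤w)

  Ŷ-approach-in-X̂∪Ŷ : ∀ {a b} {A : Walk Ĝ a b} → Ŷ a → AllInit (¬_ ∘ X̂) A → X̂ b → All X̂∪Ŷ (verts Ĝ A)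
  Ŷ-approach-in-X̂∪Ŷ ŷ ¬x̂-init x̂ =
    AllInit⇒All (AllInit-map Ŷ⇒X̂∪Ŷ (AllInit-propagate Ŷ-closed ŷ ¬x̂-init)) (X̂⇒X̂∪Ŷ x̂)

  open Segmentation (OldIn? k {X})

  segment-cases : ∀ {x y} {S : Walk Ĝ x y} → IsSegment S → All X̂∪Ŷ (verts Ĝ S) ⊎ + 0 < w S
  segment-cases (segment {A = []} x̂ [] ŷ) = inj₁ (X̂⇒X̂∪Ŷ x̂ ∷ X̂⇒X̂∪Ŷ ŷ ∷ [])
  segment-cases (segment {w = v} {j = j} {A = A@(step _ _ _)} x̂ inner@(¬x̂ ∷ _) x̂′) with classify v
  ... | inj₁ x̂v = ⊥-elim (¬x̂ x̂v)
  ... | inj₂ (inj₁ ŷv) = inj₁ (X̂⇒X̂∪Ŷ x̂ ∷ Ŷ-approach-in-X̂∪Ŷ ŷv inner x̂′)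
  ... | inj₂ (inj₂ ẑv) =
        inj₂ (step-pos j A (Ẑ-edge-weight (Joins-sym j) ẑv)
                           (Ẑ-walk-nonneg (AllInit-propagate Ẑ-closed ẑv inner)))

  segment-nonneg : ∀ {x y} {S : Walk Ĝ x y} → IsSegment S → IsPath Ĝ S → + 0 ≤ w S
  segment-nonneg {S = S} s@(segment x̂ _ ŷ) path with segment-cases s
  ... | inj₁ in-XY = X̂∪Ŷ-path-nonneg S x̂ ŷ in-XY path
  ... | inj₂ w>0 = ℤ.<⇒≤ w>0

  segment-pos : ∀ {x y} {S : Walk Ĝ x y} → IsSegment S → Meets Ẑ S → + 0 < w S
  segment-pos {S = S} s meets with segment-cases s
  ... | inj₁ in-XY = ⊥-elim (All¬⇒¬Meets S (All.map X̂∪Ŷ⇒¬Ẑ in-XY) meets)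
  ... | inj₂ w>0 = w>0

  open SegmentWeights F̂ X̂⇒¬Ẑ segment-nonneg segment-pos

  X̂-X̂-path-pos : ∀ {a b} (Q : Walk Ĝ a b) → X̂ a → X̂ b → IsPath Ĝ Q → Meets Ẑ Q → + 0 < w Q
  X̂-X̂-path-pos Q x̂a x̂b = segments-pos (segmentsFrom x̂a (decompose x̂b Q))

  Ẑ-X̂-path-pos : ∀ {a b} (Q : Walk Ĝ a b) → Ẑ a → X̂ b → IsPath Ĝ Q → + 0 < w Q
  Ẑ-X̂-path-pos Q ẑ x̂ path with decompose x̂ Q
  ... | decomposition {A = []} [] segs = ⊥-elim (X̂⇒¬Ẑ (Segments-start segs) ẑ)
  ... | decomposition {A = A@(step _ _ _)} {B} approach segs =
        subst (+ 0 <_) (sym (wF-++ʷ F̂ A B))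
          (ℤ.+-mono-<-≤ (Ẑ-walk-pos (AllInit-propagate Ẑ-closed ẑ approach))
                        (segments-nonneg segs (proj₂ (IsPath-++ʷ⁻ A B path))))

  X̂-Ẑ-path-pos : ∀ {a b} (Q : Walk Ĝ a b) → X̂ a → OldIn k Z b → IsPath Ĝ Q → + 0 < w Q
  X̂-Ẑ-path-pos Q x̂ z path =
    subst (+ 0 <_) (wF-reverse F̂ Q) (Ẑ-X̂-path-pos (reverse Q) (inj₁ z) x̂ (IsPath-reverse Q path))

  X̂-path-pos : ∀ {a b} (Q : Walk Ĝ a b) → IsPath Ĝ Q → X̂ a → X̂ b ⊎ OldIn k Z b → Meets Ẑ Q →
               + 0 < w Q
  X̂-path-pos Q path x̂a (inj₁ x̂b) meets = X̂-X̂-path-pos Q x̂a x̂b path meets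
  X̂-path-pos Q path x̂a (inj₂ zb) _ = X̂-Ẑ-path-pos Q x̂a zb path

  closed-walk-through-X̂-pos : ∀ {u x} (C : Walk Ĝ u u) → x ∈ₗ verts Ĝ C → X̂ x →
                              Unique (tailVerts C) → Meets Ẑ C → + 0 < w C
  closed-walk-through-X̂-pos C x∈ x̂ unique meets with split-at C x∈
  ... | A , B , refl =
        subst (+ 0 <_) (wF-++ʷ-comm F̂ B A)
          (closed-segments-pos (segmentsFrom x̂ (decompose x̂ (B ++ʷ A)))
                               (Unique-tailVerts-++ʷ-comm A B unique) (Meets-++ʷ-comm A B meets))

  closed-walk-avoiding-X̂-pos : ∀ {ê u v} {j : Joins Ĝ ê u v} (p : Walk Ĝ v u) →
                               All (¬_ ∘ X̂) (verts Ĝ (step ê j p)) → Meets Ẑ (step ê j p) →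
                               + 0 < w (step ê j p)
  closed-walk-avoiding-X̂-pos {u = u} {j = j} p ¬x̂s meets with classify u | All⇒AllInit {p = step _ j p} ¬x̂s
  ... | inj₁ x̂u | _ = ⊥-elim (All.head ¬x̂s x̂u)
  ... | inj₂ (inj₁ ŷu) | ¬x̂-init =
        let in-Y = AllInit⇒All (AllInit-propagate Ŷ-closed ŷu ¬x̂-init) ŷu
        in ⊥-elim (All¬⇒¬Meets (step _ j p) (All.map (X̂∪Ŷ⇒¬Ẑ ∘ Ŷ⇒X̂∪Ŷ) in-Y) meets)
  ... | inj₂ (inj₂ ẑu) | ¬x̂-init = Ẑ-walk-pos (AllInit-propagate Ẑ-closed ẑu ¬x̂-init)

  circuit-pos : ∀ {u} (C : Walk Ĝ u u) → IsCircuit Ĝ C → Meets Ẑ C → + 0 < w C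
  circuit-pos C@(step ê j p) (_ , unique) meets with any? (OldIn? k {X}) (verts Ĝ p)
  ... | yes some-x̂ = let x , x∈ , x̂ = find some-x̂ in closed-walk-through-X̂-pos C (there x∈) x̂ unique meets
  ... | no no-x̂ = let ¬x̂s = All.¬Any⇒All¬ (verts Ĝ p) no-x̂ in
                   closed-walk-avoiding-X̂-pos {j = j} p (All.lookup ¬x̂s (end∈verts p) ∷ ¬x̂s) meets

  X̂∪Ŷ-path-μ-bound : ∀ {y x} (A : Walk Ĝ (ι y) (ι x)) → x ∈ X → All X̂∪Ŷ (verts Ĝ A) → IsPath Ĝ A →
                     Σ[ μ ∈ ℤ ] IsMinLambda G F X y μ × μ ≤ w A
  X̂∪Ŷ-path-μ-bound A x∈X in-XY path with lift-path A in-XY path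
  ... | P , path-P , weight≡ with Enumeration.μ-exists G F x∈X (Walks.reverse G P) (Walks.IsPath-reverse G P path-P)
  ... | μ , min-μ , μ≤ = μ , min-μ , subst (μ ≤_) (trans (Walks.wF-reverse G F P) weight≡) μ≤

  Ŷ-path-bound : ∀ y {b} (Q : Walk Ĝ (ι y) b) → y ∈ Y → IsPath Ĝ Q → X̂ b → Meets Ẑ Q →
                 ∃[ μ ] IsMinLambda G F X y μ × μ < w Q
  Ŷ-path-bound y Q y∈Y path x̂b meets with decompose x̂b Q
  ... | decomposition {A = A} {B} approach segs with Segments-start segs
  ... | x̂@(x , x∈X , refl) =
        let path-A , path-B = IsPath-++ʷ⁻ A B path
            in-XY = Ŷ-approach-in-X̂∪Ŷ (y , y∈Y , refl) approach x̂
            μ , min-μ , μ≤wA = X̂∪Ŷ-path-μ-bound A x∈X in-XY path-A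
            meets-B = [ ⊥-elim ∘ All¬⇒¬Meets A (All.map X̂∪Ŷ⇒¬Ẑ in-XY) , id ]′ (Meets-++ʷ⁻ A B meets)
        in μ , min-μ , subst₂ _<_ (ℤ.+-identityʳ μ) (sym (wF-++ʷ F̂ A B))
                                  (ℤ.+-mono-≤-< μ≤wA (segments-pos segs path-B meets-B))

lemma6p3 : ∀ {n m} (G : Graph n m) (T : Subset n) (F : Subset m) (X Y Z : Subset n)
    → IsMinJoin G T F
    → IsExtreme G F X
    → (∀ v → v ∈ Y → v ∈ Z → ⊥)
    → (∀ v → v ∉ X → v ∈ Y ⊎ v ∈ Z)
    → (∀ v → v ∈ Y ⊎ v ∈ Z → v ∉ X)
    → (∀ e → (proj₁ (G e) ∈ Y → proj₂ (G e) ∈ Z → ⊥) × (proj₁ (G e) ∈ Z → proj₂ (G e) ∈ Y → ⊥))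
    → (∀ e → e ∈ F → proj₁ (G e) ∉ Z × proj₂ (G e) ∉ Z)
    → ∀ {k l} (N : Fin l → Fin n × Fin k)
    → (∀ i → proj₁ (N i) ∈ X)
    → ((∀ {u} (Q : Walk (extend G N) u u) → IsCircuit (extend G N) Q
          → MeetsZhat (extend G N) Z Q → + 0 < wF (extend G N) (extendF l F) Q)
       × (∀ {a b} (Q : Walk (extend G N) a b) → IsPath (extend G N) Q
          → OldIn k X a → (OldIn k X b ⊎ OldIn k Z b)
          → MeetsZhat (extend G N) Z Q → + 0 < wF (extend G N) (extendF l F) Q))
       × (∀ y {b} (Q : Walk (extend G N) (y ↑ˡ k) b) → y ∈ Y → IsPath (extend G N) Q
          → OldIn k X b → MeetsZhat (extend G N) Z Q
          → ∃[ μ ] IsMinLambda G F X y μ × μ < wF (extend G N) (extendF l F) Q)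
lemma6p3 G T F X Y Z _ extreme Y-disjoint-Z XYZ-cover X-disjoint-YZ YZ-edgeless F-avoids-Z N N-from-X =
  (circuit-pos , X̂-path-pos) , Ŷ-path-bound
  where open Extension G F X Y Z extreme Y-disjoint-Z XYZ-cover X-disjoint-YZ YZ-edgeless F-avoids-Z N N-from-X
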